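{- Let $H$ be a 3-graph with underlying graph $G$. If $G$ has a block with an even number of vertices, then $H$ has no spanning tree.
   Context: A 3-graph is $H=(V,\Delta)$ with $\Delta\subseteq\binom V3$ (triples). Its underlying graph $G$ is the multigraph on $V$ with an edge $ab$ for each triple containing $\{a,b\}$. A block of $G$ is a maximal 2-connected subgraph. A cycle in $H$ is a sequence $a_0,t_1,a_1,\dots,t_\ell,a_\ell=a_0$, $\ell\ge2$, of distinct vertices $a_0,\dots,a_{\ell-1}$ and distinct triples with $a_{i-1},a_i\in t_i$. A spanning tree is a set of triples containing no cycle, covering $V$, connected via paths of triples. -}

module Defs where

open import Level using (Level; suc; zero) renaming (_⊔_ to _⊔ˡ_)
open import Data.Nat using (ℕ; _≤_; _<_)
open import Data.Nat.Divisibility using (_∣_)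
open import Data.Fin using (Fin; inject₁; fromℕ) renaming (suc to fsuc; zero to fzero; _<_ to _<ᶠ_)
open import Data.Fin.Subset using (Subset; _∈_; _∉_; ∣_∣) renaming (_⊆_ to _⊆ˢ_)
open import Data.Product using (Σ; _×_; ∃; ∃-syntax; _,_)
open import Data.Sum using (_⊎_)
open import Relation.Binary.PropositionalEquality using (_≡_; _≢_)
open import Relation.Binary.Construct.Closure.ReflexiveTransitive using (Star)
open import Relation.Nullary using (¬_)
open import Function.Definitions using (Injective)

-- A 3-graph H = (V, Δ) with V = Fin n and Δ ⊆ (V choose 3).
-- The triples are listed injectively as Δ : Fin m → Subset n, each of
-- cardinality 3; a set of triples of H is a Subset m of indices.

record ThreeGraph (n : ℕ) : Set where
  field
    m        : ℕ
    Δ        : Fin m → Subset n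
    Δ-inj    : Injective _≡_ _≡_ Δ
    Δ-triple : ∀ i → ∣ Δ i ∣ ≡ 3

module _ {n : ℕ} (H : ThreeGraph n) where
  open ThreeGraph H

  -- Cycles of H using only triples from T ⊆ Δ:
  -- a₀, t₁, a₁, …, t_ℓ, a_ℓ = a₀ with ℓ ≥ 2, a₀,…,a_{ℓ-1} distinct,
  -- t₁,…,t_ℓ distinct, and a_{i-1}, a_i ∈ t_i.
  -- Here a : Fin (ℓ+1) → V and t : Fin ℓ → (indices of triples), where
  -- t i (0-based) plays the role of t_{i+1}.

  record CycleIn (T : Subset m) : Set where
    field
      ℓ       : ℕ
      2≤ℓ     : 2 ≤ ℓ
      a       : Fin (Data.Nat.suc ℓ) → Fin n
      t       : Fin ℓ → Fin m
      closed  : a (fromℕ ℓ) ≡ a fzero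
      a-inj   : Injective _≡_ _≡_ (λ i → a (inject₁ i))
      t-inj   : Injective _≡_ _≡_ t
      t∈T     : ∀ i → t i ∈ T
      a-left  : ∀ i → a (inject₁ i) ∈ Δ (t i)
      a-right : ∀ i → a (fsuc i) ∈ Δ (t i)

  TAdj : Subset m → Fin n → Fin n → Set
  TAdj T u v = ∃[ i ] (i ∈ T × u ∈ Δ i × v ∈ Δ i)

  record SpanningTree (T : Subset m) : Set where
    field
      acyclic   : ¬ CycleIn T
      covering  : ∀ v → ∃[ i ] (i ∈ T × v ∈ Δ i)
      connected : ∀ u v → Star (TAdj T) u v

  HasSpanningTree : Set
  HasSpanningTree = ∃[ T ] SpanningTree T

  -- The underlying multigraph G: one edge ab for every triple i and
  -- every pair {a,b} ⊆ Δ i (pairs represented with a < b).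

  Edge : Set
  Edge = Σ (Fin m) λ i → Σ (Fin n) λ x → Σ (Fin n) λ y →
           x <ᶠ y × x ∈ Δ i × y ∈ Δ i

  Ends : Edge → Fin n → Fin n → Set
  Ends (_ , x , y , _) u v = (u ≡ x × v ≡ y) ⊎ (u ≡ y × v ≡ x)

  IncidentTo : Edge → Fin n → Set
  IncidentTo (_ , x , y , _) w = w ≡ x ⊎ w ≡ y

  record Subgraph : Set₁ where
    field
      VS    : Subset n
      ES    : Edge → Set
      ES-ok : ∀ e → ES e → ∀ w → IncidentTo e w → w ∈ VS
  open Subgraph

  _⊑_ : Subgraph → Subgraph → Set
  B ⊑ B' = (VS B ⊆ˢ VS B') × (∀ e → ES B e → ES B' e)

  ConnectedAvoiding : Subgraph → (Fin n → Set) → Set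
  ConnectedAvoiding B removed =
    ∀ u v → u ∈ VS B → ¬ removed u → v ∈ VS B → ¬ removed v →
      Star (λ x y → ∃[ e ] (ES B e × Ends e x y × ¬ removed x × ¬ removed y)) u v

  TwoConnected : Subgraph → Set
  TwoConnected B =
    2 < ∣ VS B ∣ ×
    ConnectedAvoiding B (λ _ → Data.Empty.⊥) ×
    (∀ x → x ∈ VS B → ConnectedAvoiding B (λ w → w ≡ x))
    where import Data.Empty

  IsBlock : Subgraph → Set₁
  IsBlock B = TwoConnected B × (∀ B' → TwoConnected B' → B ⊑ B' → B' ⊑ B)

-- Let U be the vertex set of the block and T a spanning tree.  A triple meeting U in two
-- vertices lies inside U, and a T-walk that leaves U can only re-enter U where it left it: in
-- both cases a path outside U between two vertices of U would be an ear, and adding it would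
-- give a larger 2-connected subgraph.  Hence the triples of T inside U connect U.  As T is
-- acyclic, a triple of T leaving a connected part S ⊆ U meets S in exactly one vertex, so
-- growing S from a single vertex one triple at a time adds two vertices per step: ∣U∣ is odd.

module Submission where

open import Defs
open import Data.Nat using (ℕ; suc; _+_; _∸_; _<_; s≤s; z≤n)
import Data.Nat.Properties as ℕ
open import Data.Nat.Divisibility using (_∣_; ∣m+n∣m⇒∣n; ∣-refl; ∣⇒≤)
open import Data.Nat.Induction using (<-wellFounded)
open import Induction.WellFounded using (Acc; acc)
open import Data.Vec using ([]; _∷_)
open import Data.Fin using (Fin; fromℕ; inject₁; _≟_) renaming (zero to fzero; suc to fsuc)
open import Data.Fin.Properties using (inject₁-injective; <-cmp; any?)
open import Data.Fin.Subset using (Subset; _∈_; _∉_; _∪_; _∩_; ⁅_⁆; ∣_∣; Nonempty; inside; outside)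
  renaming (_⊆_ to _⊆ˢ_)
open import Data.Fin.Subset.Properties
  using ( _∈?_; _⊆?_; nonempty?; Empty-unique; ∣⊥∣≡0; p⊆p∪q; q⊆p∪q; x∈p∪q⁻; x∈p∩q⁻; x∈p∩q⁺
        ; x∈⁅x⁆; x∈⁅y⁆⇒x≡y; ⊆-antisym; ∣p∣≤n; ∣⁅x⁆∣≡1; p⊆q⇒∣p∣≤∣q∣)
open import Data.Product using (Σ; ∃-syntax; _×_; _,_; proj₁; proj₂)
open import Data.Sum using (_⊎_; inj₁; inj₂; [_,_]; map₁; map₂)
open import Data.Empty using (⊥; ⊥-elim)
open import Data.Unit using (⊤; tt)
open import Function using (id; _∘_)
open import Relation.Nullary using (¬_; Dec; yes; no)
open import Relation.Nullary.Decidable using (_×-dec_; ¬?; decidable-stable)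
open import Relation.Binary using (tri<; tri≈; tri>)
open import Relation.Binary.Definitions using (DecidableEquality)
open import Relation.Binary.PropositionalEquality
  using (_≡_; _≢_; refl; sym; trans; cong; subst; module ≡-Reasoning)
open import Relation.Binary.Construct.Closure.ReflexiveTransitive using (Star; ε; _◅_; _◅◅_; reverse)
import Relation.Binary.Construct.Closure.ReflexiveTransitive as Star


module Walks {A : Set} (R : A → A → Set) where

  infix 4 _∈ʷ_ _⊆ʷ_

  _∈ʷ_ : ∀ {a b} → A → Star R a b → Set
  _∈ʷ_ {a} w ε       = w ≡ a
  _∈ʷ_ {a} w (_ ◅ π) = w ≡ a ⊎ w ∈ʷ π

  _⊆ʷ_ : ∀ {a b c d} → Star R a b → Star R c d → Set
  ρ ⊆ʷ π = ∀ {w} → w ∈ʷ ρ → w ∈ʷ π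

  IsPath : ∀ {a b} → Star R a b → Set
  IsPath ε           = ⊤
  IsPath {a} (_ ◅ π) = ¬ a ∈ʷ π × IsPath π

  first-∈ʷ : ∀ {a b} (π : Star R a b) → a ∈ʷ π
  first-∈ʷ ε       = refl
  first-∈ʷ (_ ◅ _) = inj₁ refl

  last-∈ʷ : ∀ {a b} (π : Star R a b) → b ∈ʷ π
  last-∈ʷ ε       = refl
  last-∈ʷ (_ ◅ π) = inj₂ (last-∈ʷ π)

  ∈ʷ-◅◅-◅ε⁻ : ∀ {a b c w} (π : Star R a b) (r : R b c) → w ∈ʷ π ◅◅ (r ◅ ε) → w ∈ʷ π ⊎ w ≡ c
  ∈ʷ-◅◅-◅ε⁻ ε       r (inj₁ w≡a) = inj₁ w≡a
  ∈ʷ-◅◅-◅ε⁻ ε       r (inj₂ w≡c) = inj₂ w≡c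
  ∈ʷ-◅◅-◅ε⁻ (_ ◅ π) r (inj₁ w≡a) = inj₁ (inj₁ w≡a)
  ∈ʷ-◅◅-◅ε⁻ (_ ◅ π) r (inj₂ w∈)  = map₁ inj₂ (∈ʷ-◅◅-◅ε⁻ π r w∈)

  dropUntil : ∀ {a b w} (π : Star R a b) → w ∈ʷ π →
              Σ (Star R w b) λ ρ → (IsPath π → IsPath ρ) × ρ ⊆ʷ π
  dropUntil ε       refl        = ε , id , id
  dropUntil (r ◅ π) (inj₁ refl) = r ◅ π , id , id
  dropUntil (r ◅ π) (inj₂ w∈) with dropUntil π w∈
  ... | ρ , path , ρ⊆π = ρ , path ∘ proj₂ , inj₂ ∘ ρ⊆π

  module _ (_≟_ : DecidableEquality A) where

    _∈ʷ?_ : ∀ {a b} w (π : Star R a b) → Dec (w ∈ʷ π)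
    _∈ʷ?_ {a} w ε = w ≟ a
    _∈ʷ?_ {a} w (_ ◅ π) with w ≟ a | w ∈ʷ? π
    ... | yes w≡a | _       = yes (inj₁ w≡a)
    ... | no  _   | yes w∈π = yes (inj₂ w∈π)
    ... | no  w≢a | no  w∉π = no [ w≢a , w∉π ]

    toPath : ∀ {a b} (π : Star R a b) → Σ (Star R a b) λ ρ → IsPath ρ × ρ ⊆ʷ π
    toPath ε = ε , tt , id
    toPath {a} (r ◅ π) with toPath π
    ... | ρ , path , ρ⊆π with a ∈ʷ? ρ
    ...   | yes a∈ρ = let ρ′ , path′ , ρ′⊆ρ = dropUntil ρ a∈ρ in ρ′ , path′ path , inj₂ ∘ ρ⊆π ∘ ρ′⊆ρ
    ...   | no  a∉ρ = r ◅ ρ , (a∉ρ , path) , map₂ ρ⊆π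

  length : ∀ {a b} → Star R a b → ℕ
  length ε       = 0
  length (_ ◅ π) = suc (length π)

  vertexAt : ∀ {a b} (π : Star R a b) → Fin (suc (length π)) → A
  vertexAt {a} π       fzero    = a
  vertexAt     (_ ◅ π) (fsuc i) = vertexAt π i

  vertexAt-last : ∀ {a b} (π : Star R a b) → vertexAt π (fromℕ (length π)) ≡ b
  vertexAt-last ε       = refl
  vertexAt-last (_ ◅ π) = vertexAt-last π

  vertexAt-∈ʷ : ∀ {a b} (π : Star R a b) i → vertexAt π i ∈ʷ π
  vertexAt-∈ʷ π       fzero    = first-∈ʷ π
  vertexAt-∈ʷ (_ ◅ π) (fsuc i) = inj₂ (vertexAt-∈ʷ π i)

  vertexAt-injective : ∀ {a b} (π : Star R a b) → IsPath π → ∀ {i j} → vertexAt π i ≡ vertexAt π j → i ≡ j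
  vertexAt-injective π       _          {fzero}  {fzero}  _ = refl
  vertexAt-injective (_ ◅ π) (a∉π , _) {fzero}  {fsuc j} e = ⊥-elim (a∉π (subst (_∈ʷ π) (sym e) (vertexAt-∈ʷ π j)))
  vertexAt-injective (_ ◅ π) (a∉π , _) {fsuc i} {fzero}  e = ⊥-elim (a∉π (subst (_∈ʷ π) e (vertexAt-∈ʷ π i)))
  vertexAt-injective (_ ◅ π) (_ , path) {fsuc i} {fsuc j} e = cong fsuc (vertexAt-injective π path e)

  vertexAt-inject₁-≢-last : ∀ {a b} (π : Star R a b) → IsPath π → ∀ i → vertexAt π (inject₁ i) ≢ b
  vertexAt-inject₁-≢-last (_ ◅ π) (a∉π , _) fzero    a≡b = a∉π (subst (_∈ʷ π) (sym a≡b) (last-∈ʷ π))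
  vertexAt-inject₁-≢-last (_ ◅ π) (_ , path) (fsuc i)    = vertexAt-inject₁-≢-last π path i

exitStep : ∀ {A : Set} {R : A → A → Set} {S : A → Set} → (∀ x → Dec (S x)) →
           ∀ {x y} → Star R x y → S x → ¬ S y → Σ A λ p → Σ A λ q → R p q × S p × ¬ S q
exitStep S? ε x∈S y∉S = ⊥-elim (y∉S x∈S)
exitStep S? (_◅_ {i = p} {j = q} r σ) p∈S y∉S with S? q
... | yes q∈S = exitStep S? σ q∈S y∉S
... | no  q∉S = p , q , r , p∈S , q∉S


module TripleWalks {n : ℕ} (H : ThreeGraph n) where
  open ThreeGraph H

  Adj : (Fin m → Set) → Fin n → Fin n → Set
  Adj P x y = ∃[ i ] (P i × x ∈ Δ i × y ∈ Δ i)

  Adj-sym : ∀ {P x y} → Adj P x y → Adj P y x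
  Adj-sym (i , Pi , x∈ , y∈) = i , Pi , y∈ , x∈

  Within : Subset m → Subset n → Fin m → Set
  Within T S i = i ∈ T × Δ i ⊆ˢ S

  ConnectedWithin : Subset m → Subset n → Set
  ConnectedWithin T S = ∀ {a b} → a ∈ S → b ∈ S → Star (Adj (Within T S)) a b

  module _ {P : Fin m → Set} where
    open Walks (Adj P)

    infix 4 _∈ᵗ_

    _∈ᵗ_ : ∀ {a b} → Fin m → Star (Adj P) a b → Set
    s ∈ᵗ ε             = ⊥
    s ∈ᵗ ((i , _) ◅ π) = i ≡ s ⊎ s ∈ᵗ π

    _∈ᵗ?_ : ∀ {a b} s (π : Star (Adj P) a b) → Dec (s ∈ᵗ π)
    s ∈ᵗ? ε = no λ ()
    s ∈ᵗ? ((i , _) ◅ π) with i ≟ s | s ∈ᵗ? π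
    ... | yes i≡s | _       = yes (inj₁ i≡s)
    ... | no  _   | yes s∈π = yes (inj₂ s∈π)
    ... | no  i≢s | no  s∉π = no [ i≢s , s∉π ]

    DistinctTriples : ∀ {a b} → Star (Adj P) a b → Set
    DistinctTriples ε             = ⊤
    DistinctTriples ((i , _) ◅ π) = ¬ i ∈ᵗ π × DistinctTriples π

    dropThrough : ∀ {a b s} (π : Star (Adj P) a b) → s ∈ᵗ π → DistinctTriples π →
                  Σ (Fin n) λ c → c ∈ Δ s × Σ (Star (Adj P) c b) λ ρ →
                    ¬ s ∈ᵗ ρ × DistinctTriples ρ × (IsPath π → IsPath ρ) × ρ ⊆ʷ π
    dropThrough (_◅_ {j = c} (_ , _ , _ , c∈) π) (inj₁ refl) (s∉π , distinct) =
      c , c∈ , π , s∉π , distinct , proj₂ , inj₂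
    dropThrough (_ ◅ π) (inj₂ s∈π) (_ , distinct) with dropThrough π s∈π distinct
    ... | c , c∈ , ρ , s∉ρ , distinct′ , path , ρ⊆π = c , c∈ , ρ , s∉ρ , distinct′ , path ∘ proj₂ , inj₂ ∘ ρ⊆π

    -- If the first triple s of the walk is used again later, go through s straight to where
    -- that later use leads.
    shortcutTriples : ∀ {a b} (π : Star (Adj P) a b) → IsPath π →
                      Σ (Star (Adj P) a b) λ ρ → IsPath ρ × DistinctTriples ρ × ρ ⊆ʷ π
    shortcutTriples ε _ = ε , tt , tt , id
    shortcutTriples (r@(s , Ps , a∈ , _) ◅ π) (a∉π , path) with shortcutTriples π path
    ... | ρ , pathρ , distinct , ρ⊆π with s ∈ᵗ? ρ
    ...   | no  s∉ρ = r ◅ ρ , (a∉π ∘ ρ⊆π , pathρ) , (s∉ρ , distinct) , map₂ ρ⊆π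
    ...   | yes s∈ρ with dropThrough ρ s∈ρ distinct
    ...     | c , c∈ , ρ′ , s∉ρ′ , distinct′ , path′ , ρ′⊆ρ =
              (s , Ps , a∈ , c∈) ◅ ρ′ , (a∉π ∘ ρ⊆π ∘ ρ′⊆ρ , path′ pathρ) , (s∉ρ′ , distinct′) , map₂ (ρ⊆π ∘ ρ′⊆ρ)

    toTriplePath : ∀ {a b} (π : Star (Adj P) a b) → Σ (Star (Adj P) a b) λ ρ → IsPath ρ × DistinctTriples ρ
    toTriplePath π with toPath _≟_ π
    ... | ρ , path , _ with shortcutTriples ρ path
    ...   | ρ′ , path′ , distinct , _ = ρ′ , path′ , distinct

    tripleAt : ∀ {a b} (π : Star (Adj P) a b) → Fin (length π) → Fin m
    tripleAt ((i , _) ◅ π) fzero    = i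
    tripleAt (_       ◅ π) (fsuc j) = tripleAt π j

    tripleAt-allowed : ∀ {a b} (π : Star (Adj P) a b) j → P (tripleAt π j)
    tripleAt-allowed ((_ , Pi , _) ◅ π) fzero    = Pi
    tripleAt-allowed (_             ◅ π) (fsuc j) = tripleAt-allowed π j

    tripleAt-∈ᵗ : ∀ {a b} (π : Star (Adj P) a b) j → tripleAt π j ∈ᵗ π
    tripleAt-∈ᵗ (_ ◅ π) fzero    = inj₁ refl
    tripleAt-∈ᵗ (_ ◅ π) (fsuc j) = inj₂ (tripleAt-∈ᵗ π j)

    tripleAt-injective : ∀ {a b} (π : Star (Adj P) a b) → DistinctTriples π →
                         ∀ {i j} → tripleAt π i ≡ tripleAt π j → i ≡ j
    tripleAt-injective (_ ◅ π) _           {fzero}  {fzero}  _ = refl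
    tripleAt-injective (_ ◅ π) (s∉π , _)   {fzero}  {fsuc j} e = ⊥-elim (s∉π (subst (_∈ᵗ π) (sym e) (tripleAt-∈ᵗ π j)))
    tripleAt-injective (_ ◅ π) (s∉π , _)   {fsuc i} {fzero}  e = ⊥-elim (s∉π (subst (_∈ᵗ π) e (tripleAt-∈ᵗ π i)))
    tripleAt-injective (_ ◅ π) (_ , dist)  {fsuc i} {fsuc j} e = cong fsuc (tripleAt-injective π dist e)

    vertexAt-∈-tripleAtˡ : ∀ {a b} (π : Star (Adj P) a b) j → vertexAt π (inject₁ j) ∈ Δ (tripleAt π j)
    vertexAt-∈-tripleAtˡ ((_ , _ , a∈ , _) ◅ π) fzero    = a∈
    vertexAt-∈-tripleAtˡ (_                 ◅ π) (fsuc j) = vertexAt-∈-tripleAtˡ π j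

    vertexAt-∈-tripleAtʳ : ∀ {a b} (π : Star (Adj P) a b) j → vertexAt π (fsuc j) ∈ Δ (tripleAt π j)
    vertexAt-∈-tripleAtʳ ((_ , _ , _ , c∈) ◅ π) fzero    = c∈
    vertexAt-∈-tripleAtʳ (_                 ◅ π) (fsuc j) = vertexAt-∈-tripleAtʳ π j

  module _ (T : Subset m) {t : Fin m} (t∈T : t ∈ T) where
    open Walks (Adj (λ i → i ∈ T × i ≢ t))

    -- The cycle is b, t, a, followed by the path from a back to b.
    cycleOfPath : ∀ {a b} → a ∈ Δ t → b ∈ Δ t → a ≢ b → (π : Star (Adj (λ i → i ∈ T × i ≢ t)) a b) →
                  IsPath π → DistinctTriples π → CycleIn H T
    cycleOfPath a∈t b∈t a≢b ε _ _ = ⊥-elim (a≢b refl)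
    cycleOfPath {a} {b} a∈t b∈t a≢b π@(_ ◅ _) path distinct = record
      { ℓ       = suc (length π)
      ; 2≤ℓ     = s≤s (s≤s z≤n)
      ; a       = vertex
      ; t       = triple
      ; closed  = vertexAt-last π
      ; a-inj   = vertex-injective
      ; t-inj   = triple-injective
      ; t∈T     = triple∈T
      ; a-left  = left
      ; a-right = right
      }
      where
      vertex : Fin (suc (suc (length π))) → Fin n
      vertex fzero    = b
      vertex (fsuc i) = vertexAt π i

      triple : Fin (suc (length π)) → Fin m
      triple fzero    = t
      triple (fsuc j) = tripleAt π j

      vertex-injective : ∀ {i j} → vertex (inject₁ i) ≡ vertex (inject₁ j) → i ≡ j
      vertex-injective {fzero}  {fzero}  _ = refl
      vertex-injective {fzero}  {fsuc j} e = ⊥-elim (vertexAt-inject₁-≢-last π path j (sym e))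
      vertex-injective {fsuc i} {fzero}  e = ⊥-elim (vertexAt-inject₁-≢-last π path i e)
      vertex-injective {fsuc i} {fsuc j} e = cong fsuc (inject₁-injective (vertexAt-injective π path e))

      triple-injective : ∀ {i j} → triple i ≡ triple j → i ≡ j
      triple-injective {fzero}  {fzero}  _ = refl
      triple-injective {fzero}  {fsuc j} e = ⊥-elim (proj₂ (tripleAt-allowed π j) (sym e))
      triple-injective {fsuc i} {fzero}  e = ⊥-elim (proj₂ (tripleAt-allowed π i) e)
      triple-injective {fsuc i} {fsuc j} e = cong fsuc (tripleAt-injective π distinct e)

      triple∈T : ∀ j → triple j ∈ T
      triple∈T fzero    = t∈T
      triple∈T (fsuc j) = proj₁ (tripleAt-allowed π j)

      left : ∀ j → vertex (inject₁ j) ∈ Δ (triple j)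
      left fzero    = b∈t
      left (fsuc j) = vertexAt-∈-tripleAtˡ π j

      right : ∀ j → vertex (fsuc j) ∈ Δ (triple j)
      right fzero    = a∈t
      right (fsuc j) = vertexAt-∈-tripleAtʳ π j

    cycleThrough : ∀ {a b} → a ∈ Δ t → b ∈ Δ t → a ≢ b → Star (Adj (λ i → i ∈ T × i ≢ t)) a b → CycleIn H T
    cycleThrough a∈t b∈t a≢b walk =
      let π , path , distinct = toTriplePath walk in cycleOfPath a∈t b∈t a≢b π path distinct


module UnderlyingGraph {n : ℕ} (H : ThreeGraph n) where
  open ThreeGraph H
  open Subgraph

  Adjacent : Fin n → Fin n → Set
  Adjacent x y = ∃[ e ] Ends H e x y

  Ends-sym : ∀ {e x y} → Ends H e x y → Ends H e y x
  Ends-sym {_ , _} (inj₁ (p , q)) = inj₂ (q , p)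
  Ends-sym {_ , _} (inj₂ (p , q)) = inj₁ (q , p)

  Ends⇒IncidentToˡ : ∀ {e x y} → Ends H e x y → IncidentTo H e x
  Ends⇒IncidentToˡ {_ , _} (inj₁ (refl , refl)) = inj₁ refl
  Ends⇒IncidentToˡ {_ , _} (inj₂ (refl , refl)) = inj₂ refl

  Ends⇒IncidentToʳ : ∀ {e x y} → Ends H e x y → IncidentTo H e y
  Ends⇒IncidentToʳ {e} = Ends⇒IncidentToˡ {e} ∘ Ends-sym {e}

  IncidentTo⇒Ends : ∀ {e x y w} → Ends H e x y → IncidentTo H e w → w ≡ x ⊎ w ≡ y
  IncidentTo⇒Ends {_ , _} (inj₁ (refl , refl)) (inj₁ refl) = inj₁ refl
  IncidentTo⇒Ends {_ , _} (inj₁ (refl , refl)) (inj₂ refl) = inj₂ refl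
  IncidentTo⇒Ends {_ , _} (inj₂ (refl , refl)) (inj₁ refl) = inj₂ refl
  IncidentTo⇒Ends {_ , _} (inj₂ (refl , refl)) (inj₂ refl) = inj₁ refl

  adjacent : ∀ {s a b} → a ≢ b → a ∈ Δ s → b ∈ Δ s → Adjacent a b
  adjacent {s} {a} {b} a≢b a∈ b∈ with <-cmp a b
  ... | tri< a<b _ _ = (s , a , b , a<b , a∈ , b∈) , inj₁ (refl , refl)
  ... | tri≈ _ a≡b _ = ⊥-elim (a≢b a≡b)
  ... | tri> _ _ b<a = (s , b , a , b<a , b∈ , a∈) , inj₂ (refl , refl)

  Step : (Edge H → Set) → (Fin n → Set) → Fin n → Fin n → Set
  Step E removed x y = ∃[ e ] (E e × Ends H e x y × ¬ removed x × ¬ removed y)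

  Step-sym : ∀ {E removed x y} → Step E removed x y → Step E removed y x
  Step-sym (e , e∈ , ends , x-ok , y-ok) = e , e∈ , Ends-sym {e} ends , y-ok , x-ok

  Step-target : ∀ {E removed w c} → Star (Step E removed) w c → ¬ removed w → ¬ removed c
  Step-target ε                            w-ok = w-ok
  Step-target ((_ , _ , _ , _ , c-ok) ◅ σ) _ = Step-target σ c-ok

  open Walks Adjacent

  vertexSet : ∀ {a b} → Star Adjacent a b → Subset n
  vertexSet {a} ε       = ⁅ a ⁆
  vertexSet {a} (_ ◅ π) = ⁅ a ⁆ ∪ vertexSet π

  ∈ʷ⇒∈vertexSet : ∀ {a b w} (π : Star Adjacent a b) → w ∈ʷ π → w ∈ vertexSet π
  ∈ʷ⇒∈vertexSet ε       refl        = x∈⁅x⁆ _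
  ∈ʷ⇒∈vertexSet (_ ◅ π) (inj₁ refl) = p⊆p∪q _ (x∈⁅x⁆ _)
  ∈ʷ⇒∈vertexSet (_ ◅ π) (inj₂ w∈)  = q⊆p∪q _ _ (∈ʷ⇒∈vertexSet π w∈)

  ∈vertexSet⇒∈ʷ : ∀ {a b w} (π : Star Adjacent a b) → w ∈ vertexSet π → w ∈ʷ π
  ∈vertexSet⇒∈ʷ {a} ε       w∈ = x∈⁅y⁆⇒x≡y a w∈
  ∈vertexSet⇒∈ʷ {a} (_ ◅ π) w∈ with x∈p∪q⁻ ⁅ a ⁆ (vertexSet π) w∈
  ... | inj₁ w∈a = inj₁ (x∈⁅y⁆⇒x≡y a w∈a)
  ... | inj₂ w∈π = inj₂ (∈vertexSet⇒∈ʷ π w∈π)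

  _∈ᵉ_ : ∀ {a b} → Edge H → Star Adjacent a b → Set
  e ∈ᵉ ε                      = ⊥
  _∈ᵉ_ {a} e (_◅_ {j = c} _ π) = Ends H e a c ⊎ e ∈ᵉ π

  ∈ᵉ-incident : ∀ {a b e w} (π : Star Adjacent a b) → e ∈ᵉ π → IncidentTo H e w → w ∈ʷ π
  ∈ᵉ-incident {e = e} (_ ◅ π) (inj₁ ends) inc with IncidentTo⇒Ends {e} ends inc
  ... | inj₁ refl = inj₁ refl
  ... | inj₂ refl = inj₂ (first-∈ʷ π)
  ∈ᵉ-incident (_ ◅ π) (inj₂ e∈π) inc = inj₂ (∈ᵉ-incident π e∈π inc)

  walkToEnd : ∀ {E removed a b w} (π : Star Adjacent a b) → (∀ {e} → e ∈ᵉ π → E e) →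
              (∀ {v} → v ∈ʷ π → ¬ removed v) → w ∈ʷ π → Star (Step E removed) w b
  walkToEnd ε _ _ refl = ε
  walkToEnd (_◅_ {j = c} (e , ends) π) π⊆E π-ok (inj₁ refl) =
    (e , π⊆E (inj₁ ends) , ends , π-ok (inj₁ refl) , π-ok (inj₂ (first-∈ʷ π))) ◅
    walkToEnd π (π⊆E ∘ inj₂) (π-ok ∘ inj₂) (first-∈ʷ π)
  walkToEnd (_ ◅ π) π⊆E π-ok (inj₂ w∈π) = walkToEnd π (π⊆E ∘ inj₂) (π-ok ∘ inj₂) w∈π

  -- On a path, z occurs at most once, so one of the two ends is reachable along the path without z.
  walkToEndAvoiding : ∀ {E z a b w} (π : Star Adjacent a b) → IsPath π → (∀ {e} → e ∈ᵉ π → E e) →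
                      w ∈ʷ π → w ≢ z → Star (Step E (_≡ z)) w a ⊎ Star (Step E (_≡ z)) w b
  walkToEndAvoiding ε       _ _ refl _ = inj₁ ε
  walkToEndAvoiding (_ ◅ π) _ _ (inj₁ refl) _ = inj₁ ε
  walkToEndAvoiding {z = z} {a} (_◅_ (e , ends) π) (a∉π , path) π⊆E (inj₂ w∈π) w≢z
    with walkToEndAvoiding π path (π⊆E ∘ inj₂) w∈π w≢z
  ... | inj₂ σ = inj₂ σ
  ... | inj₁ σ with z ≟ a
  ...   | yes refl = inj₂ (walkToEnd π (π⊆E ∘ inj₂) (λ v∈π v≡a → a∉π (subst (_∈ʷ π) v≡a v∈π)) w∈π)
  ...   | no  z≢a  = inj₁ (σ ◅◅ ((e , π⊆E (inj₁ ends) , Ends-sym {e} ends , Step-target σ w≢z , z≢a ∘ sym) ◅ ε))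

  _∪ᵖ_ : ∀ {a b} → Subgraph H → Star Adjacent a b → Subgraph H
  B ∪ᵖ π = record
    { VS    = VS B ∪ vertexSet π
    ; ES    = λ e → ES B e ⊎ e ∈ᵉ π
    ; ES-ok = λ { e (inj₁ e∈B) w inc → p⊆p∪q (vertexSet π) (ES-ok B e e∈B w inc)
                ; e (inj₂ e∈π) w inc → q⊆p∪q (VS B) _ (∈ʷ⇒∈vertexSet π (∈ᵉ-incident π e∈π inc)) }
    }

  ⊑-∪ᵖ : ∀ {a b} (B : Subgraph H) (π : Star Adjacent a b) → _⊑_ H B (B ∪ᵖ π)
  ⊑-∪ᵖ B π = p⊆p∪q (vertexSet π) , λ _ → inj₁

  connectedAvoiding-∪ᵖ : ∀ {a b} (B : Subgraph H) (π : Star Adjacent a b) removed →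
    (∀ w → w ∈ VS (B ∪ᵖ π) → ¬ removed w →
       ∃[ c ] (c ∈ VS B × ¬ removed c × Star (Step (ES (B ∪ᵖ π)) removed) w c)) →
    (∀ u v → u ∈ VS B → ¬ removed u → v ∈ VS B → ¬ removed v → Star (Step (ES (B ∪ᵖ π)) removed) u v) →
    ConnectedAvoiding H (B ∪ᵖ π) removed
  connectedAvoiding-∪ᵖ B π removed enter connectedB u v u∈ u-ok v∈ v-ok
    with enter u u∈ u-ok | enter v v∈ v-ok
  ... | c , c∈ , c-ok , σ | d , d∈ , d-ok , τ =
    σ ◅◅ connectedB c d c∈ c-ok d∈ d-ok ◅◅ reverse Step-sym τ

  twoConnected-∪ᵖ : ∀ {a b} (B : Subgraph H) → TwoConnected H B → a ∈ VS B → b ∈ VS B →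
                    (π : Star Adjacent a b) → IsPath π → TwoConnected H (B ∪ᵖ π)
  twoConnected-∪ᵖ {a} {b} B (2<∣B∣ , connectedB , connectedB-z) a∈B b∈B π path =
    ℕ.<-≤-trans 2<∣B∣ (p⊆q⇒∣p∣≤∣q∣ (p⊆p∪q {p = VS B} (vertexSet π))) ,
    connectedAvoiding-∪ᵖ B π _ enter (λ u v u∈ u-ok v∈ v-ok → fromB (connectedB u v u∈ u-ok v∈ v-ok)) ,
    λ z _ → connectedAvoiding-∪ᵖ B π (_≡ z) (enterAvoiding z) (connectedAvoiding z)
    where
    ES′ : Edge H → Set
    ES′ = ES (B ∪ᵖ π)

    fromB : ∀ {removed u v} → Star (Step (ES B) removed) u v → Star (Step ES′ removed) u v
    fromB = Star.map λ (e , e∈B , rest) → e , inj₁ e∈B , rest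

    enter : ∀ w → w ∈ VS (B ∪ᵖ π) → ¬ ⊥ → ∃[ c ] (c ∈ VS B × ¬ ⊥ × Star (Step ES′ (λ _ → ⊥)) w c)
    enter w w∈ w-ok with x∈p∪q⁻ (VS B) (vertexSet π) w∈
    ... | inj₁ w∈B = w , w∈B , w-ok , ε
    ... | inj₂ w∈π = b , b∈B , w-ok , walkToEnd π inj₂ (λ _ ()) (∈vertexSet⇒∈ʷ π w∈π)

    enterAvoiding : ∀ z w → w ∈ VS (B ∪ᵖ π) → w ≢ z → ∃[ c ] (c ∈ VS B × c ≢ z × Star (Step ES′ (_≡ z)) w c)
    enterAvoiding z w w∈ w≢z with x∈p∪q⁻ (VS B) (vertexSet π) w∈
    ... | inj₁ w∈B = w , w∈B , w≢z , ε
    ... | inj₂ w∈π with walkToEndAvoiding π path inj₂ (∈vertexSet⇒∈ʷ π w∈π) w≢z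
    ...   | inj₁ σ = a , a∈B , Step-target σ w≢z , σ
    ...   | inj₂ σ = b , b∈B , Step-target σ w≢z , σ

    -- If z lies outside B, any walk in B already avoids it.
    connectedAvoiding : ∀ z u v → u ∈ VS B → u ≢ z → v ∈ VS B → v ≢ z → Star (Step ES′ (_≡ z)) u v
    connectedAvoiding z u v u∈ u≢z v∈ v≢z with z ∈? VS B
    ... | yes z∈B = fromB (connectedB-z z z∈B u v u∈ u≢z v∈ v≢z)
    ... | no  z∉B = Star.map avoid (connectedB u v u∈ (λ ()) v∈ (λ ()))
      where
      avoid : ∀ {x y} → Step (ES B) (λ _ → ⊥) x y → Step ES′ (_≡ z) x y
      avoid (e , e∈B , ends , _) =
        e , inj₁ e∈B , ends ,
        (λ { refl → z∉B (ES-ok B e e∈B _ (Ends⇒IncidentToˡ {e} ends)) }) ,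
        (λ { refl → z∉B (ES-ok B e e∈B _ (Ends⇒IncidentToʳ {e} ends)) })

  path-⊆-block : ∀ {a b} (B : Subgraph H) → IsBlock H B → a ∈ VS B → b ∈ VS B →
                 (π : Star Adjacent a b) → IsPath π → ∀ {w} → w ∈ʷ π → w ∈ VS B
  path-⊆-block B (twoConnected , maximal) a∈B b∈B π path w∈π =
    proj₁ (maximal (B ∪ᵖ π) (twoConnected-∪ᵖ B twoConnected a∈B b∈B π path) (⊑-∪ᵖ B π))
      (q⊆p∪q (VS B) _ (∈ʷ⇒∈vertexSet π w∈π))


module _ {n : ℕ} (H : ThreeGraph n) (B : Subgraph H) (block : IsBlock H B) where
  open ThreeGraph H
  open UnderlyingGraph H
  open TripleWalks H
  open Walks Adjacent
  private U = Subgraph.VS B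

  -- Shortened to a path, such a walk would be an ear of the block passing through w₁ ∉ U.
  no-ear : ∀ {x w₁ y} → x ∈ U → y ∈ U → Adjacent x w₁ → w₁ ∉ U →
           (π : Star Adjacent w₁ y) → ¬ x ∈ʷ π → ⊥
  no-ear x∈U y∈U r w₁∉U π x∉π with toPath _≟_ π
  ... | ρ , path , ρ⊆π =
    w₁∉U (path-⊆-block B block x∈U y∈U (r ◅ ρ) (x∉π ∘ ρ⊆π , path) (inj₂ (first-∈ʷ ρ)))

  triple-⊆-block : ∀ {s a b} → a ≢ b → a ∈ Δ s → b ∈ Δ s → a ∈ U → b ∈ U → Δ s ⊆ˢ U
  triple-⊆-block {s} {a} {b} a≢b a∈ b∈ a∈U b∈U {c} c∈ with c ∈? U
  ... | yes c∈U = c∈U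
  ... | no  c∉U = ⊥-elim (no-ear a∈U b∈U (adjacent a≢c a∈ c∈) c∉U (adjacent c≢b c∈ b∈ ◅ ε) [ a≢c , a≢b ])
    where
    a≢c : a ≢ c
    a≢c refl = c∉U a∈U
    c≢b : c ≢ b
    c≢b refl = c∉U b∈U

  module _ (T : Subset m) {v : Fin n} (v∈U : v ∈ U) where

    data Anchored (w : Fin n) : Set where
      inside  : w ∈ U → Anchored w
      outside : ∀ {x w₁} → x ∈ U → Adjacent x w₁ → (π : Star Adjacent w₁ w) →
                (∀ {u} → u ∈ʷ π → u ∉ U) → Anchored w

    anchor : ∀ {w} → Anchored w → Fin n
    anchor {w} (inside _)            = w
    anchor     (outside {x} _ _ _ _) = x

    -- An excursion out of U can only return to U at its anchor (no-ear), where it is cut out.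
    walkWithin : ∀ {w} → Star (Adj (_∈ T)) w v → (α : Anchored w) → Star (Adj (Within T U)) (anchor α) v
    walkWithin ε (inside _)           = ε
    walkWithin ε (outside _ _ π away) = ⊥-elim (away (last-∈ʷ π) v∈U)
    walkWithin {w} (_◅_ {j = w′} (i , i∈T , w∈ , w′∈) σ) (inside w∈U) with Δ i ⊆? U
    ... | yes i⊆U = (i , (i∈T , i⊆U) , w∈ , w′∈) ◅ walkWithin σ (inside (i⊆U w′∈))
    ... | no  i⊈U with w′ ∈? U | w′ ≟ w
    ...   | yes w′∈U | yes refl = walkWithin σ (inside w∈U)
    ...   | yes w′∈U | no  w′≢w = ⊥-elim (i⊈U (triple-⊆-block (w′≢w ∘ sym) w∈ w′∈ w∈U w′∈U))
    ...   | no  w′∉U | _        =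
            walkWithin σ (outside w∈U (adjacent w≢w′ w∈ w′∈) ε λ { refl → w′∉U })
      where
      w≢w′ : w ≢ w′
      w≢w′ refl = w′∉U w∈U
    walkWithin {w} (_◅_ {j = w′} (i , _ , w∈ , w′∈) σ) (outside {x} x∈U r π away) with w′ ∈? U
    ... | yes w′∈U with w′ ≟ x
    ...   | yes refl = walkWithin σ (inside x∈U)
    ...   | no  w′≢x = ⊥-elim (no-ear x∈U w′∈U r (away (first-∈ʷ π)) (π ◅◅ (adjacent w≢w′ w∈ w′∈ ◅ ε)) x∉)
      where
      w≢w′ : w ≢ w′
      w≢w′ refl = away (last-∈ʷ π) w′∈U
      x∉ : ¬ x ∈ʷ π ◅◅ (adjacent w≢w′ w∈ w′∈ ◅ ε)
      x∉ x∈ with ∈ʷ-◅◅-◅ε⁻ π _ x∈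
      ... | inj₁ x∈π  = away x∈π x∈U
      ... | inj₂ refl = w′≢x refl
    walkWithin {w} (_◅_ {j = w′} (i , _ , w∈ , w′∈) σ) (outside x∈U r π away) | no w′∉U with w′ ≟ w
    ...   | yes refl = walkWithin σ (outside x∈U r π away)
    ...   | no  w′≢w = walkWithin σ (outside x∈U r (π ◅◅ (adjacent (w′≢w ∘ sym) w∈ w′∈ ◅ ε)) away′)
      where
      away′ : ∀ {u} → u ∈ʷ π ◅◅ (adjacent (w′≢w ∘ sym) w∈ w′∈ ◅ ε) → u ∉ U
      away′ u∈ with ∈ʷ-◅◅-◅ε⁻ π _ u∈
      ... | inj₁ u∈π  = away u∈π
      ... | inj₂ refl = w′∉U

  connected-within-block : (T : Subset m) → (∀ u v → Star (TAdj H T) u v) →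
                           ConnectedWithin T U
  connected-within-block T connected {u} {v} u∈U v∈U = walkWithin T v∈U (connected u v) (inside u∈U)


∣p∪q∣+∣p∩q∣≡∣p∣+∣q∣ : ∀ {n} (p q : Subset n) → ∣ p ∪ q ∣ + ∣ p ∩ q ∣ ≡ ∣ p ∣ + ∣ q ∣
∣p∪q∣+∣p∩q∣≡∣p∣+∣q∣ []            []            = refl
∣p∪q∣+∣p∩q∣≡∣p∣+∣q∣ (inside  ∷ p) (inside  ∷ q) =
  cong suc (trans (ℕ.+-suc ∣ p ∪ q ∣ ∣ p ∩ q ∣) (trans (cong suc (∣p∪q∣+∣p∩q∣≡∣p∣+∣q∣ p q)) (sym (ℕ.+-suc ∣ p ∣ ∣ q ∣))))
∣p∪q∣+∣p∩q∣≡∣p∣+∣q∣ (inside  ∷ p) (outside ∷ q) = cong suc (∣p∪q∣+∣p∩q∣≡∣p∣+∣q∣ p q)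
∣p∪q∣+∣p∩q∣≡∣p∣+∣q∣ (outside ∷ p) (inside  ∷ q) = trans (cong suc (∣p∪q∣+∣p∩q∣≡∣p∣+∣q∣ p q)) (sym (ℕ.+-suc ∣ p ∣ ∣ q ∣))
∣p∪q∣+∣p∩q∣≡∣p∣+∣q∣ (outside ∷ p) (outside ∷ q) = ∣p∪q∣+∣p∩q∣≡∣p∣+∣q∣ p q

0<∣p∣⇒Nonempty : ∀ {n} {p : Subset n} → 0 < ∣ p ∣ → Nonempty p
0<∣p∣⇒Nonempty {n} {p} 0<∣p∣ with nonempty? p
... | yes nonempty = nonempty
... | no  empty    =
  ⊥-elim (ℕ.<-irrefl refl (subst (0 <_) (∣⊥∣≡0 n) (subst (λ X → 0 < ∣ X ∣) (Empty-unique empty) 0<∣p∣)))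


module _ {n : ℕ} (H : ThreeGraph n) (T : Subset (ThreeGraph.m H)) (acyclic : ¬ CycleIn H T) where
  open ThreeGraph H
  open TripleWalks H

  -- A second vertex z of Δ i in S would close a cycle: Δ i itself, then back inside S.
  triple-meets-once : ∀ {S i p q} → ConnectedWithin T S → i ∈ T →
                      p ∈ Δ i → p ∈ S → q ∈ Δ i → q ∉ S → S ∩ Δ i ≡ ⁅ p ⁆
  triple-meets-once {S} {i} {p} {q} connected i∈T p∈i p∈S q∈i q∉S = ⊆-antisym only-p p-∈
    where
    avoid-i : ∀ {x y} → Adj (Within T S) x y → Adj (λ j → j ∈ T × j ≢ i) x y
    avoid-i (j , (j∈T , j⊆S) , rest) = j , (j∈T , λ { refl → q∉S (j⊆S q∈i) }) , rest

    only-p : S ∩ Δ i ⊆ˢ ⁅ p ⁆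
    only-p {z} z∈ with x∈p∩q⁻ S (Δ i) z∈ | z ≟ p
    ... | _ , _       | yes refl = x∈⁅x⁆ p
    ... | z∈S , z∈i | no  z≢p  =
      ⊥-elim (acyclic (cycleThrough T i∈T p∈i z∈i (λ p≡z → z≢p (sym p≡z)) (Star.map avoid-i (connected p∈S z∈S))))

    p-∈ : ⁅ p ⁆ ⊆ˢ S ∩ Δ i
    p-∈ z∈ with x∈⁅y⁆⇒x≡y p z∈
    ... | refl = x∈p∩q⁺ (p∈S , p∈i)

  ∣S∪Δi∣≡2+∣S∣ : ∀ {S i p} → S ∩ Δ i ≡ ⁅ p ⁆ → ∣ S ∪ Δ i ∣ ≡ 2 + ∣ S ∣
  ∣S∪Δi∣≡2+∣S∣ {S} {i} {p} S∩i≡p = ℕ.suc-injective (begin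
    suc ∣ S ∪ Δ i ∣              ≡⟨ ℕ.+-comm 1 _ ⟩
    ∣ S ∪ Δ i ∣ + 1              ≡⟨ cong (∣ S ∪ Δ i ∣ +_) (sym (∣⁅x⁆∣≡1 p)) ⟩
    ∣ S ∪ Δ i ∣ + ∣ ⁅ p ⁆ ∣      ≡⟨ cong (λ X → ∣ S ∪ Δ i ∣ + ∣ X ∣) (sym S∩i≡p) ⟩
    ∣ S ∪ Δ i ∣ + ∣ S ∩ Δ i ∣    ≡⟨ ∣p∪q∣+∣p∩q∣≡∣p∣+∣q∣ S (Δ i) ⟩
    ∣ S ∣ + ∣ Δ i ∣              ≡⟨ cong (∣ S ∣ +_) (Δ-triple i) ⟩
    ∣ S ∣ + 3                    ≡⟨ ℕ.+-comm ∣ S ∣ 3 ⟩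
    3 + ∣ S ∣                    ∎)
    where open ≡-Reasoning

  connectedWithin-∪triple : ∀ {S i p} → ConnectedWithin T S → i ∈ T → p ∈ Δ i → p ∈ S →
                            ConnectedWithin T (S ∪ Δ i)
  connectedWithin-∪triple {S} {i} {p} connected i∈T p∈i p∈S a∈ b∈ = toP a∈ ◅◅ reverse Adj-sym (toP b∈)
    where
    toP : ∀ {a} → a ∈ S ∪ Δ i → Star (Adj (Within T (S ∪ Δ i))) a p
    toP {a} a∈ with x∈p∪q⁻ S (Δ i) a∈
    ... | inj₁ a∈S = Star.map (λ (j , (j∈T , j⊆S) , rest) → j , (j∈T , p⊆p∪q (Δ i) ∘ j⊆S) , rest) (connected a∈S p∈S)
    ... | inj₂ a∈i = (i , (i∈T , q⊆p∪q S (Δ i)) , a∈i , p∈i) ◅ ε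

  module _ {U : Subset n} (connectedU : ConnectedWithin T U) {u : Fin n} where

    odd-by-growth : ∀ S → Acc _<_ (n ∸ ∣ S ∣) → S ⊆ˢ U → u ∈ S → ConnectedWithin T S →
                    ¬ 2 ∣ ∣ S ∣ → ¬ 2 ∣ ∣ U ∣
    odd-by-growth S (acc smaller) S⊆U u∈S connectedS odd
      with any? (λ v → v ∈? U ×-dec ¬? (v ∈? S))
    ... | no  U⊈S = subst (λ X → ¬ 2 ∣ ∣ X ∣) (⊆-antisym S⊆U U⊆S) odd
      where
      U⊆S : U ⊆ˢ S
      U⊆S {v} v∈U = decidable-stable (v ∈? S) λ v∉S → U⊈S (v , v∈U , v∉S)
    ... | yes (v , v∈U , v∉S) with exitStep (_∈? S) (connectedU (S⊆U u∈S) v∈U) u∈S v∉S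
    ...   | p , q , (i , (i∈T , i⊆U) , p∈i , q∈i) , p∈S , q∉S =
      odd-by-growth (S ∪ Δ i) (smaller shrinks) S′⊆U (p⊆p∪q (Δ i) u∈S)
        (connectedWithin-∪triple connectedS i∈T p∈i p∈S) odd′
      where
      size : ∣ S ∪ Δ i ∣ ≡ 2 + ∣ S ∣
      size = ∣S∪Δi∣≡2+∣S∣ (triple-meets-once connectedS i∈T p∈i p∈S q∈i q∉S)

      shrinks : n ∸ ∣ S ∪ Δ i ∣ < n ∸ ∣ S ∣
      shrinks = ℕ.∸-monoʳ-< (subst (∣ S ∣ <_) (sym size) (ℕ.m<n+m ∣ S ∣ (s≤s z≤n))) (∣p∣≤n (S ∪ Δ i))

      S′⊆U : S ∪ Δ i ⊆ˢ U
      S′⊆U {z} z∈ with x∈p∪q⁻ S (Δ i) z∈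
      ... | inj₁ z∈S = S⊆U z∈S
      ... | inj₂ z∈i = i⊆U z∈i

      odd′ : ¬ 2 ∣ ∣ S ∪ Δ i ∣
      odd′ 2∣ = odd (∣m+n∣m⇒∣n (subst (2 ∣_) size 2∣) ∣-refl)

  odd-size : ∀ {U} → ConnectedWithin T U → Nonempty U → ¬ 2 ∣ ∣ U ∣
  odd-size {U} connectedU (u , u∈U) =
    odd-by-growth connectedU ⁅ u ⁆ (<-wellFounded _) ⁅u⁆⊆U (x∈⁅x⁆ u) connected-⁅u⁆ odd-⁅u⁆
    where
    ⁅u⁆⊆U : ⁅ u ⁆ ⊆ˢ U
    ⁅u⁆⊆U z∈ with x∈⁅y⁆⇒x≡y u z∈
    ... | refl = u∈U

    connected-⁅u⁆ : ConnectedWithin T ⁅ u ⁆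
    connected-⁅u⁆ a∈ b∈ with x∈⁅y⁆⇒x≡y u a∈ | x∈⁅y⁆⇒x≡y u b∈
    ... | refl | refl = ε

    odd-⁅u⁆ : ¬ 2 ∣ ∣ ⁅ u ⁆ ∣
    odd-⁅u⁆ 2∣ with ∣⇒≤ (subst (2 ∣_) (∣⁅x⁆∣≡1 u) 2∣)
    ... | s≤s ()


proposition3p7 : ∀ {n : ℕ} (H : ThreeGraph n) →
    (∃[ B ] (IsBlock H B × 2 ∣ ∣ Subgraph.VS B ∣)) →
    ¬ HasSpanningTree H
proposition3p7 H (B , block@((2<∣B∣ , _) , _) , even) (T , tree) =
  odd-size H T acyclic (connected-within-block H B block T connected)
    (0<∣p∣⇒Nonempty (ℕ.<-trans (s≤s z≤n) 2<∣B∣)) even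
  where open SpanningTree tree
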